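{- Let $Q$ be a quantale, $M$ a left $Q$-module and $\vartheta \subseteq M \times M$ a binary relation. Call $s \in M$ $\vartheta$-saturated if for all $(v,w) \in \vartheta$ and all $a \in Q$: $a v \leq s \iff a w \leq s$, and let $M_\vartheta$ be the set of $\vartheta$-saturated elements. Then $M_\vartheta$ is closed under arbitrary meets of $M$, and for every $s \in M_\vartheta$ and every $a \in Q$, the element $a\backslash s$ belongs to $M_\vartheta$.
   Context: A (unital) quantale is a complete lattice $Q$ with a monoid structure $(Q,\cdot,1)$ whose product distributes over arbitrary joins in each argument. A left $Q$-module is a complete lattice $M$ with an action $Q \times M \to M$ satisfying $(ab)u = a(bu)$, $1u = u$, and distributing over arbitrary joins in both arguments. For $a \in Q$ and $s \in M$, $a\backslash s = \max\{v \in M \mid a v \leq s\}$. -}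

module Defs where

open import Level using (Level; suc; _⊔_)
open import Relation.Unary using (Pred; _∈_)
open import Relation.Binary.PropositionalEquality using (_≡_)
open import Data.Product using (_×_; Σ; ∃-syntax; _,_)
open import Function.Bundles using (_⇔_)

record CompleteLattice (ℓ : Level) : Set (suc ℓ) where
  field
    Carrier : Set ℓ
    _≤_     : Carrier → Carrier → Set ℓ
    ≤-refl  : ∀ {x} → x ≤ x
    ≤-trans : ∀ {x y z} → x ≤ y → y ≤ z → x ≤ z
    ≤-antisym : ∀ {x y} → x ≤ y → y ≤ x → x ≡ y
    ⋁       : Pred Carrier ℓ → Carrier
    ⋁-upper : ∀ (S : Pred Carrier ℓ) {x} → x ∈ S → x ≤ ⋁ S
    ⋁-least : ∀ (S : Pred Carrier ℓ) {u} → (∀ {x} → x ∈ S → x ≤ u) → ⋁ S ≤ u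
    ⋀       : Pred Carrier ℓ → Carrier
    ⋀-lower : ∀ (S : Pred Carrier ℓ) {x} → x ∈ S → ⋀ S ≤ x
    ⋀-greatest : ∀ (S : Pred Carrier ℓ) {u} → (∀ {x} → x ∈ S → u ≤ x) → u ≤ ⋀ S

image : ∀ {ℓ} {A B : Set ℓ} → (A → B) → Pred A ℓ → Pred B ℓ
image f S b = ∃[ a ] (a ∈ S × f a ≡ b)

record Quantale (ℓ : Level) : Set (suc ℓ) where
  field
    lattice : CompleteLattice ℓ
  open CompleteLattice lattice public
  field
    _·_    : Carrier → Carrier → Carrier
    one    : Carrier
    ·-assoc : ∀ x y z → (x · y) · z ≡ x · (y · z)
    ·-identityˡ : ∀ x → one · x ≡ x
    ·-identityʳ : ∀ x → x · one ≡ x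
    ·-distribˡ-⋁ : ∀ a (S : Pred Carrier ℓ) → a · ⋁ S ≡ ⋁ (image (a ·_) S)
    ·-distribʳ-⋁ : ∀ (S : Pred Carrier ℓ) a → ⋁ S · a ≡ ⋁ (image (_· a) S)

record LeftModule {ℓ : Level} (Q : Quantale ℓ) : Set (suc ℓ) where
  module Q = Quantale Q
  field
    lattice : CompleteLattice ℓ
  open CompleteLattice lattice public
  field
    _∙_ : Q.Carrier → Carrier → Carrier
    ∙-assoc : ∀ a b u → (a Q.· b) ∙ u ≡ a ∙ (b ∙ u)
    ∙-identity : ∀ u → Q.one ∙ u ≡ u
    ∙-distribˡ-⋁ : ∀ a (S : Pred Carrier ℓ) → a ∙ ⋁ S ≡ ⋁ (image (a ∙_) S)
    ∙-distribʳ-⋁ : ∀ (S : Pred Q.Carrier ℓ) u → Q.⋁ S ∙ u ≡ ⋁ (image (_∙ u) S)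

module _ {ℓ : Level} {Q : Quantale ℓ} (M : LeftModule Q) where
  open LeftModule M

  -- a \ s : the largest v with a v ≤ s, defined as the join of all such v.
  residual : Q.Carrier → Carrier → Carrier
  residual a s = ⋁ (λ v → (a ∙ v) ≤ s)

  Saturated : (θ : Carrier → Carrier → Set ℓ) → Pred Carrier ℓ
  Saturated θ s = ∀ v w → θ v w → ∀ (a : Q.Carrier) → ((a ∙ v) ≤ s) ⇔ ((a ∙ w) ≤ s)

-- Both closure properties hold because membership in M_θ is tested by
-- inequalities of the form  a v ≤ s.  A bound below a meet ⋀ S is a bound
-- below every element of S, so saturation passes to meets.  For residuals,
-- b v ≤ a\s holds iff (a b) v ≤ s, so saturation of a\s at the scalar b is
-- saturation of s at the scalar a b.
module Submission where

open import Defs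
open import Level using (Level)
open import Relation.Unary using (Pred; _⊆_; _∈_)
open import Data.Product using (_×_; _,_)
open import Function.Bundles using (_⇔_; mk⇔; Equivalence)
open import Function.Properties.Equivalence using () renaming (trans to ⇔-trans; sym to ⇔-sym)
open import Relation.Binary.PropositionalEquality using (_≡_; refl; sym; subst)

module CompleteLatticeProperties {ℓ : Level} (L : CompleteLattice ℓ) where
  open CompleteLattice L

  ⋁-downset : ∀ y → ⋁ (_≤ y) ≡ y
  ⋁-downset y = ≤-antisym (⋁-least (_≤ y) (λ x≤y → x≤y)) (⋁-upper (_≤ y) ≤-refl)

  ≤-⋀ : ∀ (S : Pred Carrier ℓ) {u} → u ≤ ⋀ S ⇔ (∀ {x} → x ∈ S → u ≤ x)
  ≤-⋀ S = mk⇔ (λ u≤⋀S {x} x∈S → ≤-trans u≤⋀S (⋀-lower S x∈S)) (λ bound → ⋀-greatest S bound)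

  ≤-respˡ-≡ : ∀ {x y z} → x ≡ y → x ≤ z → y ≤ z
  ≤-respˡ-≡ refl x≤z = x≤z

module LeftModuleProperties {ℓ : Level} {Q : Quantale ℓ} (M : LeftModule Q) where
  open LeftModule M
  open CompleteLatticeProperties lattice

  ∙-monoʳ-≤ : ∀ a {x y} → x ≤ y → (a ∙ x) ≤ (a ∙ y)
  ∙-monoʳ-≤ a {x} {y} x≤y =
    subst (λ t → (a ∙ x) ≤ (a ∙ t)) (⋁-downset y)
      (subst ((a ∙ x) ≤_) (sym (∙-distribˡ-⋁ a (_≤ y)))
        (⋁-upper (image (a ∙_) (_≤ y)) (x , x≤y , refl)))

  ∙-residual-≤ : ∀ a s → (a ∙ residual M a s) ≤ s
  ∙-residual-≤ a s =
    ≤-respˡ-≡ (sym (∙-distribˡ-⋁ a (λ v → (a ∙ v) ≤ s)))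
      (⋁-least _ λ { (v , av≤s , refl) → av≤s })

  residual-galois : ∀ a s {v} → (a ∙ v) ≤ s ⇔ v ≤ residual M a s
  residual-galois a s = mk⇔ (⋁-upper (λ v → (a ∙ v) ≤ s))
    (λ v≤a\s → ≤-trans (∙-monoʳ-≤ a v≤a\s) (∙-residual-≤ a s))

  ∙-≤-residual : ∀ a s b v → (b ∙ v) ≤ residual M a s ⇔ ((a Q.· b) ∙ v) ≤ s
  ∙-≤-residual a s b v =
    ⇔-trans (⇔-sym (residual-galois a s))
      (mk⇔ (≤-respˡ-≡ (sym (∙-assoc a b v))) (≤-respˡ-≡ (∙-assoc a b v)))

  module _ (θ : Carrier → Carrier → Set ℓ) where

    ⋀-saturated : ∀ (S : Pred Carrier ℓ) → S ⊆ Saturated M θ → ⋀ S ∈ Saturated M θ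
    ⋀-saturated S S-sat v w vθw a =
      ⇔-trans (≤-⋀ S) (⇔-trans bounds-iff (⇔-sym (≤-⋀ S)))
      where
      bounds-iff : (∀ {x} → x ∈ S → (a ∙ v) ≤ x) ⇔ (∀ {x} → x ∈ S → (a ∙ w) ≤ x)
      bounds-iff = mk⇔
        (λ h {x} x∈S → Equivalence.to   (S-sat x∈S v w vθw a) (h x∈S))
        (λ h {x} x∈S → Equivalence.from (S-sat x∈S v w vθw a) (h x∈S))

    residual-saturated : ∀ s a → s ∈ Saturated M θ → residual M a s ∈ Saturated M θ
    residual-saturated s a s-sat v w vθw b =
      ⇔-trans (∙-≤-residual a s b v)
        (⇔-trans (s-sat v w vθw (a Q.· b)) (⇔-sym (∙-≤-residual a s b w)))

proposition1p5 : ∀ {ℓ : Level} (Q : Quantale ℓ) (M : LeftModule Q) (θ : LeftModule.Carrier M → LeftModule.Carrier M → Set ℓ) → (∀ (S : Pred (LeftModule.Carrier M) ℓ) → S ⊆ Saturated M θ → LeftModule.⋀ M S ∈ Saturated M θ) × (∀ (s : LeftModule.Carrier M) (a : Quantale.Carrier Q) → s ∈ Saturated M θ → residual M a s ∈ Saturated M θ)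
proposition1p5 Q M θ = ⋀-saturated θ , residual-saturated θ
  where open LeftModuleProperties M
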